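{- Let $s,t$ be positive integers, put $q=s-1$ and $r=s+t-1$, and let $u_{ -1}=1/s$, $u_0=1$, $u_n=ru_{n-1}+su_{n-2}$ for $n\ge1$. Every nonnegative integer $m$ has a unique representation $R(m)=\sum_{i=0}^{n}d_iu_i$ with digits $d_i\in\{0,\dots,r\}$ satisfying $d_{i+1}=r\implies d_i\le q$ for all $i\ge0$. Let $m$ be a positive integer with $R(m)=\sum_{i=0}^{n}d_iu_i$ (digits $d_i=0$ for $i>n$). (i) Suppose that for some integer $k\ge 0$ we have $d_{2j}=q$ and $d_{2j+1}=r$ for all $0\le j<k$, that $d_{2k}\in\{0,\dots,q\}$, and that $d_{2k}=q\implies d_{2k+1}<r$. Then $R(m+1)=(d_{2k}+1)u_{2k}+\sum_{i=2k+1}^{n}d_iu_i$, so $m+1$ is evil. (ii) Suppose that for some integer $k\ge 0$ we have $d_{2j}=r$ for all $0\le j\le k$ and $d_{2j+1}=q$ for all $0\le j<k$, that $d_{2k+1}\in\{0,\dots,q\}$, and that $d_{2k+1}=q\implies d_{2k+2}<r$. Then $R(m+1)=(d_{2k+1}+1)u_{2k+1}+\sum_{i=2k+2}^{n}d_iu_i$, so $m+1$ is old.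
   Context: A positive integer $m$ is called evil if its representation $R(m)$ (as described) ends in an even number (possibly zero) of zero digits, i.e. the least index $i$ with $d_i\ne0$ is even; it is called old if $R(m)$ ends in an odd number of zero digits. By convention $0$ is both evil and old. -}

module Defs where

open import Data.Nat using (ℕ; zero; suc; _+_; _*_; _∸_; _≤_; _<_; _<ᵇ_; _≡ᵇ_)
open import Data.Bool using (if_then_else_)
open import Data.Product using (Σ; ∃; _×_; _,_)
open import Data.Sum using (_⊎_)
open import Relation.Binary.PropositionalEquality using (_≡_; _≢_)

qq : ℕ → ℕ
qq s = s ∸ 1

rr : ℕ → ℕ → ℕ
rr s t = s + t ∸ 1

-- u_0 = 1, u_1 = r u_0 + s u_{-1} = r + 1, u_{n+2} = r u_{n+1} + s u_n.
u : ℕ → ℕ → ℕ → ℕ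
u s t zero = 1
u s t (suc zero) = rr s t + 1
u s t (suc (suc n)) = rr s t * u s t (suc n) + s * u s t n

value : ℕ → ℕ → (ℕ → ℕ) → ℕ → ℕ
value s t d zero = d 0 * u s t 0
value s t d (suc n) = value s t d n + d (suc n) * u s t (suc n)

IsRep : ℕ → ℕ → ℕ → (ℕ → ℕ) → Set
IsRep s t m d =
  Σ ℕ λ n →
    (∀ i → n < i → d i ≡ 0) ×
    (∀ i → d i ≤ rr s t) ×
    (∀ i → d (suc i) ≡ rr s t → d i ≤ qq s) ×
    (value s t d n ≡ m)

LeastNonzero : (ℕ → ℕ) → ℕ → Set
LeastNonzero d i = (d i ≢ 0) × (∀ j → j < i → d j ≡ 0)

IsEven : ℕ → Set
IsEven i = ∃ λ j → i ≡ 2 * j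

IsOdd : ℕ → Set
IsOdd i = ∃ λ j → i ≡ suc (2 * j)

-- m is evil if the representation R(m) ends in an even number of zero digits;
-- 0 is evil by convention.  (R(m) is unique, as stated in the paper.)
Evil : ℕ → ℕ → ℕ → Set
Evil s t m = (m ≡ 0) ⊎ (∃ λ d → ∃ λ i → IsRep s t m d × LeastNonzero d i × IsEven i)

Old : ℕ → ℕ → ℕ → Set
Old s t m = (m ≡ 0) ⊎ (∃ λ d → ∃ λ i → IsRep s t m d × LeastNonzero d i × IsOdd i)

bump : ℕ → (ℕ → ℕ) → ℕ → ℕ
bump p d i = if i <ᵇ p then 0 else (if i ≡ᵇ p then suc (d i) else d i)

{-# OPTIONS --safe #-}
-- Since s = q + 1, the recurrence reads u_{n+2} - 1 = (u_n - 1) + q u_n + r u_{n+1}.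
-- Hence the digits d_0 … d_{p-1} = q, r, …, q, r (resp. r, q, r, …, q, r) are worth
-- exactly u_p - 1, so adding 1 clears them and raises d_p by one.  The hypotheses
-- on d_p and d_{p+1} keep the new digit sequence admissible, and p is its least
-- nonzero index, which is even in (i) and odd in (ii).
module Submission where

open import Defs
open import Data.Nat using (ℕ; zero; suc; _+_; _*_; _≤_; _<_; z≤n; s≤s; z<s)
open import Data.Nat.Properties
open import Algebra.Properties.CommutativeSemigroup +-commutativeSemigroup
  using (xy∙z≈xz∙y; xy∙z≈zy∙x)
open import Data.Product using (_×_; _,_; proj₁; proj₂)
open import Data.Sum using (inj₂)
open import Function using (_∘_)
open import Relation.Binary using (tri<; tri≈; tri>)
open import Relation.Binary.PropositionalEquality
open import Data.Nat.Tactic.RingSolver using (solve-∀)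

sumBelow : (ℕ → ℕ) → ℕ → ℕ
sumBelow f zero = 0
sumBelow f (suc n) = sumBelow f n + f n

sumBelow-support : ∀ {f n} → (∀ i → n ≤ i → f i ≡ 0) → ∀ j →
  sumBelow f (j + n) ≡ sumBelow f n
sumBelow-support f≡0 zero = refl
sumBelow-support {f} {n} f≡0 (suc j) = begin
  sumBelow f (j + n) + f (j + n)  ≡⟨ cong (sumBelow f (j + n) +_) (f≡0 _ (m≤n+m n j)) ⟩
  sumBelow f (j + n) + 0          ≡⟨ +-identityʳ _ ⟩
  sumBelow f (j + n)              ≡⟨ sumBelow-support f≡0 j ⟩
  sumBelow f n                    ∎
  where open ≡-Reasoning

valueBelow : ℕ → ℕ → (ℕ → ℕ) → ℕ → ℕ
valueBelow s t d = sumBelow (λ i → d i * u s t i)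

value≡valueBelow : ∀ s t d n → value s t d n ≡ valueBelow s t d (suc n)
value≡valueBelow s t d zero = refl
value≡valueBelow s t d (suc n) = cong (_+ d (suc n) * u s t (suc n)) (value≡valueBelow s t d n)

-- bump (suc p) d (suc i) computes to bump p (d ∘ suc) i.
bump-below : ∀ {p d i} → i < p → bump p d i ≡ 0
bump-below {suc p} {d} {zero} _ = refl
bump-below {suc p} {d} {suc i} (s≤s i<p) = bump-below {p} {d ∘ suc} i<p

bump-at : ∀ {p d} → bump p d p ≡ suc (d p)
bump-at {zero} = refl
bump-at {suc p} {d} = bump-at {p} {d ∘ suc}

bump-above : ∀ {p d i} → p < i → bump p d i ≡ d i
bump-above {zero} {d} {suc i} _ = refl
bump-above {suc p} {d} {suc i} (s≤s p<i) = bump-above {p} {d ∘ suc} p<i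

bump-leastNonzero : ∀ p d → LeastNonzero (bump p d) p
bump-leastNonzero p d =
  (λ bump≡0 → 1+n≢0 (trans (sym (bump-at {p} {d})) bump≡0)) , λ j → bump-below {p} {d}

bump-vanish : ∀ {n p d} → (∀ i → n < i → d i ≡ 0) →
  ∀ i → n + p < i → bump p d i ≡ 0
bump-vanish {n} {p} {d} vanish i n+p<i =
  trans (bump-above {p} {d} (≤-<-trans (m≤n+m p n) n+p<i))
        (vanish i (≤-<-trans (m≤m+n n p) n+p<i))

bump-bounded : ∀ {b p d} → (∀ i → d i ≤ b) → d p < b → ∀ i → bump p d i ≤ b
bump-bounded {b} {p} {d} d≤b dp<b i with <-cmp i p
... | tri< i<p _ _ rewrite bump-below {p} {d} i<p = z≤n
... | tri≈ _ refl _ rewrite bump-at {p} {d} = dp<b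
... | tri> _ _ p<i rewrite bump-above {p} {d} p<i = d≤b i

bump-admissible : ∀ {a b p d} → (∀ i → d (suc i) ≡ b → d i ≤ a) →
  (d (suc p) ≡ b → d p < a) → ∀ i → bump p d (suc i) ≡ b → bump p d i ≤ a
bump-admissible {a} {b} {p} {d} admissible next≡b⇒dp<a i next≡b with <-cmp i p
... | tri< i<p _ _ rewrite bump-below {p} {d} i<p = z≤n
... | tri≈ _ refl _ rewrite bump-at {p} {d} | bump-above {p} {d} (n<1+n p) =
  next≡b⇒dp<a next≡b
... | tri> _ _ p<i rewrite bump-above {p} {d} p<i | bump-above {p} {d} (m<n⇒m<1+n p<i) =
  admissible i next≡b

bump-sumBelow-zero : ∀ {w : ℕ → ℕ} {p d} n → n ≤ p →
  sumBelow (λ i → bump p d i * w i) n ≡ 0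
bump-sumBelow-zero zero _ = refl
bump-sumBelow-zero {w} {p} {d} (suc n) n<p
  rewrite bump-sumBelow-zero {w} {p} {d} n (<⇒≤ n<p) | bump-below {p} {d} n<p = refl

sumBelow-bump : ∀ {w : ℕ → ℕ} {p d} j →
  sumBelow (λ i → bump p d i * w i) (suc (j + p)) + sumBelow (λ i → d i * w i) p
    ≡ sumBelow (λ i → d i * w i) (suc (j + p)) + w p
sumBelow-bump {w} {p} {d} zero
  rewrite bump-sumBelow-zero {w} {p} {d} p ≤-refl | bump-at {p} {d} =
    xy∙z≈zy∙x (w p) (d p * w p) (sumBelow (λ i → d i * w i) p)
sumBelow-bump {w} {p} {d} (suc j) rewrite bump-above {p} {d} (s≤s (m≤n+m p j)) = begin
  B + c + D p    ≡⟨ xy∙z≈xz∙y B c (D p) ⟩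
  B + D p + c    ≡⟨ cong (_+ c) (sumBelow-bump j) ⟩
  D N + w p + c  ≡⟨ xy∙z≈xz∙y (D N) (w p) c ⟩
  D N + c + w p  ∎
  where
  open ≡-Reasoning
  N : ℕ
  N = suc (j + p)
  D : ℕ → ℕ
  D = sumBelow (λ i → d i * w i)
  B : ℕ
  B = sumBelow (λ i → bump p d i * w i) N
  c : ℕ
  c = d N * w N

recurrence-minus-one : ∀ v q r b → v + q * (v + 1) + r * b + 1 ≡ r * b + suc q * (v + 1)
recurrence-minus-one = solve-∀

valueBelow-maxPair : ∀ {s t d n} → 1 ≤ s → valueBelow s t d n + 1 ≡ u s t n →
  d n ≡ qq s → d (suc n) ≡ rr s t →
  valueBelow s t d (suc (suc n)) + 1 ≡ u s t (suc (suc n))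
valueBelow-maxPair {suc q} {t} {d} {n} _ full dn≡q dn+1≡r
  rewrite dn≡q | dn+1≡r | sym full =
    recurrence-minus-one (valueBelow (suc q) t d n) q (rr (suc q) t) (u (suc q) t (suc n))

valueBelow-even : ∀ {s t d} → 1 ≤ s → ∀ k →
  (∀ j → j < k → (d (2 * j) ≡ qq s) × (d (2 * j + 1) ≡ rr s t)) →
  valueBelow s t d (2 * k) + 1 ≡ u s t (2 * k)
valueBelow-even _ zero _ = refl
valueBelow-even {s} {t} {d} 1≤s (suc k) maxDigits =
  subst (λ n → valueBelow s t d n + 1 ≡ u s t n) (sym (*-suc 2 k))
    (valueBelow-maxPair {d = d} {n = 2 * k} 1≤s
      (valueBelow-even {d = d} 1≤s k (λ j → maxDigits j ∘ m<n⇒m<1+n))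
      (proj₁ (maxDigits k ≤-refl))
      (trans (cong d (+-comm 1 (2 * k))) (proj₂ (maxDigits k ≤-refl))))

valueBelow-odd : ∀ {s t d} → 1 ≤ s → ∀ k →
  (∀ j → j ≤ k → d (2 * j) ≡ rr s t) → (∀ j → j < k → d (2 * j + 1) ≡ qq s) →
  valueBelow s t d (2 * k + 1) + 1 ≡ u s t (2 * k + 1)
valueBelow-odd {s} {t} {d} _ zero evenDigits _ =
  cong (_+ 1) (trans (*-identityʳ (d 0)) (evenDigits 0 z≤n))
valueBelow-odd {s} {t} {d} 1≤s (suc k) evenDigits oddDigits =
  subst (λ n → valueBelow s t d (n + 1) + 1 ≡ u s t (n + 1)) (sym (*-suc 2 k))
    (valueBelow-maxPair {d = d} {n = 2 * k + 1} 1≤s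
      (valueBelow-odd {d = d} 1≤s k (λ j → evenDigits j ∘ m≤n⇒m≤1+n)
        (λ j → oddDigits j ∘ m<n⇒m<1+n))
      (oddDigits k ≤-refl)
      (trans (cong d 2k+2≡2[k+1]) (evenDigits (suc k) ≤-refl)))
  where
  2k+2≡2[k+1] : suc (2 * k + 1) ≡ 2 * suc k
  2k+2≡2[k+1] = trans (cong suc (+-comm (2 * k) 1)) (sym (*-suc 2 k))

bump-value : ∀ {s t m d n p} → (∀ i → n < i → d i ≡ 0) → value s t d n ≡ m →
  valueBelow s t d p + 1 ≡ u s t p → value s t (bump p d) (n + p) ≡ suc m
bump-value {s} {t} {m} {d} {n} {p} vanish value≡m full = +-cancelʳ-≡ P _ _ (begin
  value s t (bump p d) (n + p) + P
    ≡⟨ cong (_+ P) (value≡valueBelow s t (bump p d) (n + p)) ⟩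
  valueBelow s t (bump p d) (suc (n + p)) + P
    ≡⟨ sumBelow-bump n ⟩
  valueBelow s t d (suc (n + p)) + u s t p
    ≡⟨ cong₂ _+_ beyondSupport (sym full) ⟩
  value s t d n + (P + 1)
    ≡⟨ cong₂ _+_ value≡m (+-comm P 1) ⟩
  m + suc P
    ≡⟨ +-suc m P ⟩
  suc m + P ∎)
  where
  open ≡-Reasoning
  P : ℕ
  P = valueBelow s t d p
  beyondSupport : valueBelow s t d (suc (n + p)) ≡ value s t d n
  beyondSupport = begin
    valueBelow s t d (suc (n + p))
      ≡⟨ cong (valueBelow s t d) (trans (cong suc (+-comm n p)) (sym (+-suc p n))) ⟩
    valueBelow s t d (p + suc n)
      ≡⟨ sumBelow-support (λ i n<i → cong (_* u s t i) (vanish i n<i)) p ⟩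
    valueBelow s t d (suc n)
      ≡⟨ value≡valueBelow s t d n ⟨
    value s t d n ∎

q<r : ∀ {s t} → 1 ≤ s → 1 ≤ t → qq s < rr s t
q<r {suc q} {suc _} _ _ = m<m+n q z<s

bump-isRep : ∀ {s t m d p} → 1 ≤ s → 1 ≤ t → IsRep s t m d →
  valueBelow s t d p + 1 ≡ u s t p → d p ≤ qq s → (d p ≡ qq s → d (suc p) < rr s t) →
  IsRep s t (suc m) (bump p d)
bump-isRep {d = d} {p} 1≤s 1≤t (n , vanish , bounded , admissible , value≡m)
  full dp≤q noCarry =
  n + p ,
  bump-vanish {d = d} vanish ,
  bump-bounded bounded (≤-<-trans dp≤q (q<r 1≤s 1≤t)) ,
  bump-admissible admissible
    (λ next≡r → ≤∧≢⇒< dp≤q (λ dp≡q → <-irrefl next≡r (noCarry dp≡q))) ,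
  bump-value vanish value≡m full

increment-evil : ∀ {s t m d} k → 1 ≤ s → 1 ≤ t → IsRep s t m d →
  (∀ j → j < k → (d (2 * j) ≡ qq s) × (d (2 * j + 1) ≡ rr s t)) →
  d (2 * k) ≤ qq s → (d (2 * k) ≡ qq s → d (2 * k + 1) < rr s t) →
  IsRep s t (suc m) (bump (2 * k) d) × Evil s t (suc m)
increment-evil {s} {t} {m} {d} k 1≤s 1≤t rep maxDigits d2k≤q noCarry =
  rep+1 , inj₂ (bump (2 * k) d , 2 * k , rep+1 , bump-leastNonzero (2 * k) d , k , refl)
  where
  rep+1 : IsRep s t (suc m) (bump (2 * k) d)
  rep+1 = bump-isRep 1≤s 1≤t rep (valueBelow-even {d = d} 1≤s k maxDigits) d2k≤q
    (subst (λ i → d i < rr s t) (+-comm (2 * k) 1) ∘ noCarry)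

increment-old : ∀ {s t m d} k → 1 ≤ s → 1 ≤ t → IsRep s t m d →
  (∀ j → j ≤ k → d (2 * j) ≡ rr s t) → (∀ j → j < k → d (2 * j + 1) ≡ qq s) →
  d (2 * k + 1) ≤ qq s → (d (2 * k + 1) ≡ qq s → d (2 * k + 2) < rr s t) →
  IsRep s t (suc m) (bump (2 * k + 1) d) × Old s t (suc m)
increment-old {s} {t} {m} {d} k 1≤s 1≤t rep evenDigits oddDigits d2k+1≤q noCarry =
  rep+1 ,
  inj₂ (bump (2 * k + 1) d , 2 * k + 1 , rep+1 , bump-leastNonzero (2 * k + 1) d , k , +-comm (2 * k) 1)
  where
  rep+1 : IsRep s t (suc m) (bump (2 * k + 1) d)
  rep+1 = bump-isRep 1≤s 1≤t rep (valueBelow-odd {d = d} 1≤s k evenDigits oddDigits) d2k+1≤q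
    (subst (λ i → d i < rr s t) (+-suc (2 * k) 1) ∘ noCarry)

lemma1 : (s t : ℕ) → 1 ≤ s → 1 ≤ t →
    ((m : ℕ) (d : ℕ → ℕ) (k : ℕ) → 1 ≤ m → IsRep s t m d →
      (∀ j → j < k → (d (2 * j) ≡ qq s) × (d (2 * j + 1) ≡ rr s t)) →
      d (2 * k) ≤ qq s →
      (d (2 * k) ≡ qq s → d (2 * k + 1) < rr s t) →
      IsRep s t (suc m) (bump (2 * k) d) × Evil s t (suc m))
    ×
    ((m : ℕ) (d : ℕ → ℕ) (k : ℕ) → 1 ≤ m → IsRep s t m d →
      (∀ j → j ≤ k → d (2 * j) ≡ rr s t) →
      (∀ j → j < k → d (2 * j + 1) ≡ qq s) →
      d (2 * k + 1) ≤ qq s →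
      (d (2 * k + 1) ≡ qq s → d (2 * k + 2) < rr s t) →
      IsRep s t (suc m) (bump (2 * k + 1) d) × Old s t (suc m))
lemma1 s t 1≤s 1≤t =
  (λ m d k _ → increment-evil k 1≤s 1≤t) ,
  (λ m d k _ → increment-old k 1≤s 1≤t)
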